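{- If $S$ is admissible, then \[\#P(S,n)=\#\widehat{P}(S,n)+\#\widehat{P}(S\cup\{1\},n).\]
   Context: $S_n$ is the set of permutations $\pi=\pi_1\cdots\pi_n$ of $\{1,\dots,n\}$. Without padding, an index $i\in\{2,\dots,n-1\}$ is a peak of $\pi$ if $\pi_{i-1}<\pi_i>\pi_{i+1}$, and $P(S,n)$ is the set of $\pi\in S_n$ with this peak set equal to $S$. With $\pi_0=0$ prepended, an index $i\in\{1,\dots,n-1\}$ is a peak if $\pi_{i-1}<\pi_i>\pi_{i+1}$, and $\widehat{P}(S,n)$ is the set of $\pi\in S_n$ with this peak set equal to $S$. $S$ is $n$-admissible if $\#P(S,n)\neq0$; admissible means the identity is asserted for every $n$ for which $S$ is $n$-admissible. -}

module Defs where

open import Data.Bool using (Bool; true; false; _∧_; _∨_; not; if_then_else_)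
open import Data.Nat using (ℕ; zero; suc; _∸_; _<ᵇ_; _≡ᵇ_; _≤ᵇ_)
open import Data.List using (List; []; _∷_; map; concatMap; filter; length; upTo)
open import Data.Bool.ListAction using (all; any)
open import Relation.Nullary.Decidable using (Dec; yes; no)
open import Relation.Binary.PropositionalEquality using (_≡_)
open import Data.Bool.Properties using () renaming (_≟_ to _≟ᵇ_)

words : ℕ → ℕ → List (List ℕ)
words n zero    = [] ∷ []
words n (suc k) = concatMap (λ a → map (a ∷_) (words n k)) (map suc (upTo n))

_∈ᵇ_ : ℕ → List ℕ → Bool
x ∈ᵇ xs = any (λ y → x ≡ᵇ y) xs

distinct : List ℕ → Bool
distinct []       = true
distinct (x ∷ xs) = not (x ∈ᵇ xs) ∧ distinct xs

Sym : ℕ → List (List ℕ)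
Sym n = filter (λ w → distinct w ≟ᵇ true) (words n n)

-- π_i for 1 ≤ i ≤ length π (1-based); π_0 = 0 (the padding), and 0 out of range.
at : List ℕ → ℕ → ℕ
at π        zero          = 0
at []       (suc i)       = 0
at (x ∷ π)  (suc zero)    = x
at (x ∷ π)  (suc (suc i)) = at π (suc i)

peakShape : List ℕ → ℕ → Bool
peakShape π i = (at π (i ∸ 1) <ᵇ at π i) ∧ (at π (suc i) <ᵇ at π i)

isPeak : ℕ → List ℕ → ℕ → Bool
isPeak n π i = (2 ≤ᵇ i) ∧ (suc i ≤ᵇ n) ∧ peakShape π i

-- padded with π_0 = 0: i ∈ {1,…,n-1}
isPeakHat : ℕ → List ℕ → ℕ → Bool
isPeakHat n π i = (1 ≤ᵇ i) ∧ (suc i ≤ᵇ n) ∧ peakShape π i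

-- the peak set (given by its indicator p, all peaks lie in {0,…,n}) equals the finite set S
peakSetIs : ℕ → (ℕ → Bool) → List ℕ → Bool
peakSetIs n p S = all p S ∧ all (λ i → not (p i) ∨ (i ∈ᵇ S)) (upTo (suc n))

P : List ℕ → ℕ → List (List ℕ)
P S n = filter (λ π → peakSetIs n (isPeak n π) S ≟ᵇ true) (Sym n)

Phat : List ℕ → ℕ → List (List ℕ)
Phat S n = filter (λ π → peakSetIs n (isPeakHat n π) S ≟ᵇ true) (Sym n)

module Submission where

-- Fix σ ∈ Sₙ and write p = isPeak n σ (unpadded peaks) and
-- q = isPeakHat n σ (peaks after prepending σ₀ = 0).  The two indicators
-- agree at every index except 1, where p is always false; so the padded
-- peak set is the unpadded one, possibly with 1 added.  If S is admissible,
-- some permutation has all of S as unpadded peaks, hence 1 ∉ S.  Then,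
-- pointwise in σ,
--   [peaks(σ) = S] = [peaksHat(σ) = S] + [peaksHat(σ) = {1} ∪ S],
-- since exactly one of the two right-hand conditions can describe the padded
-- peak set of σ, according to whether 1 is a padded peak.  Summing over Sₙ
-- gives the identity.

open import Defs
open import Data.Nat using (ℕ; _+_)
open import Data.List using (List; length; _∷_)
open import Relation.Binary.PropositionalEquality using (_≡_; _≢_)

open import Data.Nat using (zero; suc; _≤_; _≡ᵇ_; z≤n; s≤s)
open import Data.Nat.Properties using (+-suc; +-identityʳ; _≟_; ≡ᵇ⇒≡; ≡⇒≡ᵇ)
open import Data.Bool using (Bool; true; false; _∧_; _∨_; not)
open import Data.Bool.Properties using (T-≡; ¬-not) renaming (_≟_ to _≟ᵇ_)
open import Data.Bool.ListAction using (all)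
open import Data.List using ([]; filter; upTo)
open import Data.List.Membership.Propositional using (_∈_)
open import Data.List.Membership.Propositional.Properties using (∈-upTo⁺)
open import Data.List.Relation.Unary.All as All using (All; []; _∷_)
open import Data.List.Relation.Unary.All.Properties using (all⁺)
open import Data.Product using (Σ; _×_; _,_; proj₁; proj₂)
open import Data.Empty using (⊥-elim)
open import Function.Bundles using (Equivalence)
open import Relation.Nullary using (yes; no)
open import Relation.Binary.PropositionalEquality
  using (refl; sym; trans; cong; cong₂; subst; module ≡-Reasoning)

toN : Bool → ℕ
toN true  = 1
toN false = 0

count : {A : Set} → (A → Bool) → List A → ℕ
count f xs = length (filter (λ x → f x ≟ᵇ true) xs)

count-split : {A : Set} (f g h : A → Bool) →
  (∀ x → toN (f x) ≡ toN (g x) + toN (h x)) →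
  ∀ xs → count f xs ≡ count g xs + count h xs
count-split f g h split [] = refl
count-split f g h split (x ∷ xs)
  with f x | g x | h x | split x | count-split f g h split xs
... | true  | true  | false | _  | ih = cong suc ih
... | true  | false | true  | _  | ih = trans (cong suc ih) (sym (+-suc _ _))
... | false | false | false | _  | ih = ih
... | true  | true  | true  | () | _
... | true  | false | false | () | _
... | false | true  | _     | () | _
... | false | false | true  | () | _

count-witness : {A : Set} (f : A → Bool) (xs : List A) →
  count f xs ≢ 0 → Σ A (λ x → f x ≡ true)
count-witness f []       nonzero = ⊥-elim (nonzero refl)
count-witness f (x ∷ xs) nonzero with f x in fx
... | true  = x , fx
... | false = count-witness f xs nonzero

∧-true : ∀ {a b : Bool} → a ∧ b ≡ true → a ≡ true × b ≡ true
∧-true {true} {true} refl = refl , refl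

all-cong : {A : Set} {f g : A → Bool} (xs : List A) →
  All (λ x → f x ≡ g x) xs → all f xs ≡ all g xs
all-cong []       []           = refl
all-cong (x ∷ xs) (fx≡gx ∷ eqs) = cong₂ _∧_ fx≡gx (all-cong xs eqs)

all-lookup : {A : Set} {f : A → Bool} {x : A} (xs : List A) →
  all f xs ≡ true → x ∈ xs → f x ≡ true
all-lookup {f = f} xs allTrue x∈xs =
  Equivalence.to T-≡ (All.lookup (all⁺ f xs (Equivalence.from T-≡ allTrue)) x∈xs)

≡ᵇ-false : ∀ i k → i ≢ k → (i ≡ᵇ k) ≡ false
≡ᵇ-false i k i≢k with i ≡ᵇ k in eq
... | true  = ⊥-elim (i≢k (≡ᵇ⇒≡ i k (Equivalence.from T-≡ eq)))
... | false = refl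

≡ᵇ-refl : ∀ k → (k ≡ᵇ k) ≡ true
≡ᵇ-refl k = Equivalence.to T-≡ (≡⇒≡ᵇ k k refl)

∈ᵇ-absent : ∀ {k} (S : List ℕ) → All (_≢ k) S → (k ∈ᵇ S) ≡ false
∈ᵇ-absent         []      []           = refl
∈ᵇ-absent {k} (s ∷ S) (s≢k ∷ S∌k) =
  cong₂ _∨_ (≡ᵇ-false k s (λ k≡s → s≢k (sym k≡s))) (∈ᵇ-absent S S∌k)

peakSetIs-cong : ∀ n {p q : ℕ → Bool} S → (∀ i → p i ≡ q i) →
  peakSetIs n p S ≡ peakSetIs n q S
peakSetIs-cong n S p≗q =
  cong₂ _∧_ (all-cong S (All.tabulate (λ {i} _ → p≗q i)))
            (all-cong (upTo (suc n))
               (All.tabulate (λ {i} _ → cong (λ b → not b ∨ (i ∈ᵇ S)) (p≗q i))))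

peakSetIs-⊆ : ∀ n {p : ℕ → Bool} {i} S → peakSetIs n p S ≡ true →
  p i ≡ true → i ≤ n → (i ∈ᵇ S) ≡ true
peakSetIs-⊆ n {p} {i} S isS pi i≤n = subst (λ b → (not b ∨ (i ∈ᵇ S)) ≡ true) pi covered
  where
    covered : (not (p i) ∨ (i ∈ᵇ S)) ≡ true
    covered = all-lookup (upTo (suc n)) (proj₂ (∧-true {all p S} isS)) (∈-upTo⁺ (s≤s i≤n))

peakSetIs-unmarked : ∀ n {q : ℕ → Bool} {k} S → q k ≡ false →
  peakSetIs n q (k ∷ S) ≡ false
peakSetIs-unmarked n S qk rewrite qk = refl

peakSetIs-insert : ∀ n {p q : ℕ → Bool} {k} S → All (_≢ k) S →
  p k ≡ false → q k ≡ true → (∀ i → i ≢ k → q i ≡ p i) →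
  peakSetIs n q (k ∷ S) ≡ peakSetIs n p S
peakSetIs-insert n {p} {q} {k} S S∌k pk qk agree =
  cong₂ _∧_ members covers
  where
    members : q k ∧ all q S ≡ all p S
    members rewrite qk = all-cong S (All.map (λ {i} → agree i) S∌k)
    coversAt : ∀ i → (not (q i) ∨ (i ∈ᵇ (k ∷ S))) ≡ (not (p i) ∨ (i ∈ᵇ S))
    coversAt i with i ≟ k
    ... | yes refl rewrite pk | qk | ≡ᵇ-refl k = refl
    ... | no i≢k rewrite agree i i≢k | ≡ᵇ-false i k i≢k = refl
    covers : all (λ i → not (q i) ∨ (i ∈ᵇ (k ∷ S))) (upTo (suc n))
           ≡ all (λ i → not (p i) ∨ (i ∈ᵇ S)) (upTo (suc n))
    covers = all-cong (upTo (suc n)) (All.tabulate (λ {i} _ → coversAt i))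

peakSetIs-split : ∀ n {p q : ℕ → Bool} k S → All (_≢ k) S →
  p k ≡ false → (∀ i → i ≢ k → q i ≡ p i) → (q k ≡ true → k ≤ n) →
  toN (peakSetIs n p S) ≡ toN (peakSetIs n q S) + toN (peakSetIs n q (k ∷ S))
peakSetIs-split n {p} {q} k S S∌k pk agree inRange with q k ≟ᵇ false
... | yes qk = begin
    toN (peakSetIs n p S)                ≡⟨ cong toN (peakSetIs-cong n S p≗q) ⟩
    toN (peakSetIs n q S)                ≡⟨ sym (+-identityʳ _) ⟩
    toN (peakSetIs n q S) + toN false    ≡⟨ cong (λ b → toN (peakSetIs n q S) + toN b)
                                             (sym (peakSetIs-unmarked n {q} {k} S qk)) ⟩
    toN (peakSetIs n q S) + toN (peakSetIs n q (k ∷ S)) ∎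
  where
    open ≡-Reasoning
    p≗q : ∀ i → p i ≡ q i
    p≗q i with i ≟ k
    ... | yes refl = trans pk (sym qk)
    ... | no i≢k   = sym (agree i i≢k)
... | no qk≢false = begin
    toN (peakSetIs n p S)                ≡⟨ cong toN (sym (peakSetIs-insert n S S∌k pk qk agree)) ⟩
    toN (peakSetIs n q (k ∷ S))          ≡⟨ cong (λ b → toN b + toN (peakSetIs n q (k ∷ S))) (sym qNotS) ⟩
    toN (peakSetIs n q S) + toN (peakSetIs n q (k ∷ S)) ∎
  where
    open ≡-Reasoning
    qk : q k ≡ true
    qk = ¬-not qk≢false
    -- k is marked and in range but not in S, so q does not describe S.
    qNotS : peakSetIs n q S ≡ false
    qNotS with peakSetIs n q S in isS
    ... | false = refl
    ... | true with trans (sym (peakSetIs-⊆ n S isS qk (inRange qk))) (∈ᵇ-absent S S∌k)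
    ...   | ()

marked-excludes : ∀ {p : ℕ → Bool} {k} S → all p S ≡ true → p k ≡ false →
  All (_≢ k) S
marked-excludes {p} {k} S allMarked pk = All.tabulate excluded
  where
    excluded : ∀ {s} → s ∈ S → s ≢ k
    excluded s∈S refl with trans (sym (all-lookup S allMarked s∈S)) pk
    ... | ()

isPeakHat-agrees : ∀ n σ i → i ≢ 1 → isPeakHat n σ i ≡ isPeak n σ i
isPeakHat-agrees n σ zero          _   = refl
isPeakHat-agrees n σ (suc zero)    i≢1 = ⊥-elim (i≢1 refl)
isPeakHat-agrees n σ (suc (suc i)) _   = refl

isPeakHat-one-inRange : ∀ n σ → isPeakHat n σ 1 ≡ true → 1 ≤ n
isPeakHat-one-inRange (suc n) σ _ = s≤s z≤n
isPeakHat-one-inRange zero    σ ()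

proposition4p13 : (S : List ℕ) (n : ℕ) → length (P S n) ≢ 0 →
    length (P S n) ≡ length (Phat S n) + length (Phat (1 ∷ S) n)
proposition4p13 S n admissible = count-split _ _ _ splitAt (Sym n)
  where
    -- Admissibility: a permutation whose unpadded peak set is S exists,
    -- and 1 is never an unpadded peak, so 1 ∉ S.
    witness : Σ (List ℕ) (λ π → peakSetIs n (isPeak n π) S ≡ true)
    witness = count-witness _ (Sym n) admissible
    S∌1 : All (_≢ 1) S
    S∌1 = marked-excludes S (proj₁ (∧-true (proj₂ witness))) refl
    splitAt : ∀ σ → toN (peakSetIs n (isPeak n σ) S)
                  ≡ toN (peakSetIs n (isPeakHat n σ) S) + toN (peakSetIs n (isPeakHat n σ) (1 ∷ S))
    splitAt σ = peakSetIs-split n 1 S S∌1 refl (isPeakHat-agrees n σ) (isPeakHat-one-inRange n σ)
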